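{- If $\Theta\vdash_M t:T$, where $\Theta\vdash^\top t$ is a $\beta$-normal $\mathsf{F}_{<:}^{\top}$-term and $t$ is not a $\lambda$- or $\Lambda$-abstraction, then $\Theta\vdash^\top T$, i.e. $T$ is an $\mathsf{F}_{<:}^{\top}$-type.
   Context: System $\mathsf{F}_{<:}^{K\top}$ types: $T ::= \top \mid X \mid T\to T \mid \forall^{K}(X<:T).T \mid \forall^{\top}(X<:T).T$ (up to $\alpha$-conversion). Raw terms: $t ::= \mathsf{top}\mid x\mid \lambda(x:T).t\mid \Lambda(X<:T).t\mid t\,t\mid t\{T\}$. Contexts are finite sequences of $X<:T$ and $x:T$. Subtyping $\Theta\vdash S<:T$ is generated by Var ($\Theta,X<:T,\Theta'\vdash X<:T$), Top, Refl, Trans, the arrow rule, ($\forall$-Fun) $\forall^K(X<:S).T<:\forall^K(X<:S).T'$ from $\Theta,X<:S\vdash T<:T'$, ($\forall$-Loc) $\forall^K(X<:S_0).S_1<:\forall^\top(X<:T_0).T_1$ from $T_0<:S_0$ and $\Theta,X<:S_0\vdash S_1<:T_1$, and ($\forall$-Top) $\forall^\top(X<:S_0).S_1<:\forall^\top(X<:T_0).T_1$ from $T_0<:S_0$ and $\Theta,X<:\top\vdash S_1<:T_1$. Define $\Theta^*(T)=\Theta^*(S)$ if $T$ is a variable $X$ with $\Theta=\Theta',X<:S,\Theta''$, and $\Theta^*(T)=T$ otherwise. Minimal typing judgments $\Theta\vdash_M t:T$: $\Theta,x:T,\Theta'\vdash_M x:T$; $\Theta\vdash_M\mathsf{top}:\top$;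 $\Theta\vdash_M\lambda(x:S).t:S\to T$ from $\Theta,x:S\vdash_M t:T$; $\Theta\vdash_M r\,s:T$ from $\Theta\vdash_M r:R$, $\Theta\vdash_M s:S$, $\Theta\vdash S<:S'$, where $\Theta^*(R)=S'\to T$; $\Theta\vdash_M\Lambda(X<:S).t:\forall^K(X<:S).T$ from $\Theta,X<:S\vdash_M t:T$; $\Theta\vdash_M r\{S\}:T[S/X]$ from $\Theta\vdash_M r:R$, $\Theta\vdash S<:S'$, where $\Theta^*(R)$ is $\forall^K(X<:S').T$ or $\forall^\top(X<:S').T$. An $\mathsf{F}_{<:}^{\top}$-type is a type with no $\forall^K$; $\Theta\vdash^\top T$ means $T$ and all types in $\Theta$ are $\mathsf{F}_{<:}^{\top}$-types. An $\mathsf{F}_{<:}^{\top}$-term $\Theta\vdash^\top t$ has all type annotations in $\Theta$ and $t$ being $\mathsf{F}_{<:}^{\top}$-types. A term is $\beta$-normal if it has no subterm $(\lambda(x:S).t)\,s$ or $(\Lambda(X<:S).t)\{R\}$. -}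

module Defs where

open import Data.Nat using (ℕ; zero; suc; _<_; _≥_; _∸_; _<ᵇ_; _≡ᵇ_)
open import Data.Bool using (Bool; true; false; if_then_else_)
open import Data.List using (List; []; _∷_)
open import Data.List.Relation.Unary.All using (All)
open import Data.Product using (_×_; ∃)
open import Data.Sum using (_⊎_)
open import Data.Unit using (⊤)
open import Data.Empty using (⊥)
open import Relation.Nullary using (¬_)

-- Syntax (de Bruijn indices; α-equivalence is syntactic equality).
-- Type variables and term variables live in separate namespaces:
-- a type variable index counts only type bindings (X<:S) of the context,
-- a term variable index counts only term bindings (x:T).

data Ty : Set where
  top  : Ty
  var  : ℕ → Ty
  _⇒_  : Ty → Ty → Ty
  allK : Ty → Ty → Ty   -- ∀^K (X<:S). T ; T binds index 0
  allT : Ty → Ty → Ty   -- ∀^⊤ (X<:S). T ; T binds index 0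

infixr 7 _⇒_

data Tm : Set where
  top  : Tm
  var  : ℕ → Tm
  lam  : Ty → Tm → Tm
  Lam  : Ty → Tm → Tm   -- Λ(X<:T).t  (binds type index 0)
  app  : Tm → Tm → Tm
  tapp : Tm → Ty → Tm

shiftFrom : ℕ → Ty → Ty
shiftFrom c top        = top
shiftFrom c (var k)    = if k <ᵇ c then var k else var (suc k)
shiftFrom c (S ⇒ T)    = shiftFrom c S ⇒ shiftFrom c T
shiftFrom c (allK S T) = allK (shiftFrom c S) (shiftFrom (suc c) T)
shiftFrom c (allT S T) = allT (shiftFrom c S) (shiftFrom (suc c) T)

shift : Ty → Ty
shift = shiftFrom 0

substAt : ℕ → Ty → Ty → Ty
substAt j U top        = top
substAt j U (var k)    =
  if k <ᵇ j then var k else (if k ≡ᵇ j then U else var (k ∸ 1))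
substAt j U (S ⇒ T)    = substAt j U S ⇒ substAt j U T
substAt j U (allK S T) = allK (substAt j U S) (substAt (suc j) (shift U) T)
substAt j U (allT S T) = allT (substAt j U S) (substAt (suc j) (shift U) T)

_[_] : Ty → Ty → Ty
T [ S ] = substAt 0 S T

-- Contexts: most recent binding first.  The type in an entry lives in
-- the scope of the bindings after it in the list (i.e. earlier ones).

data Entry : Set where
  tyB : Ty → Entry
  tmB : Ty → Entry

Ctx : Set
Ctx = List Entry

-- bound of type variable k in Θ (expressed in the scope of Θ)
data TyLookup : Ctx → ℕ → Ty → Set where
  here     : ∀ {Θ S} → TyLookup (tyB S ∷ Θ) zero (shift S)
  there    : ∀ {Θ S k T} → TyLookup Θ k T → TyLookup (tyB S ∷ Θ) (suc k) (shift T)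
  skipTm   : ∀ {Θ S k T} → TyLookup Θ k T → TyLookup (tmB S ∷ Θ) k T

-- type of term variable x in Θ (expressed in the scope of Θ)
data TmLookup : Ctx → ℕ → Ty → Set where
  here     : ∀ {Θ S} → TmLookup (tmB S ∷ Θ) zero S
  there    : ∀ {Θ S x T} → TmLookup Θ x T → TmLookup (tmB S ∷ Θ) (suc x) T
  skipTy   : ∀ {Θ S x T} → TmLookup Θ x T → TmLookup (tyB S ∷ Θ) x (shift T)

infix 4 _⊢_<:_
data _⊢_<:_ : Ctx → Ty → Ty → Set where
  Var   : ∀ {Θ k T} → TyLookup Θ k T → Θ ⊢ var k <: T
  Top   : ∀ {Θ S} → Θ ⊢ S <: top
  Refl  : ∀ {Θ S} → Θ ⊢ S <: S
  Trans : ∀ {Θ S T U} → Θ ⊢ S <: T → Θ ⊢ T <: U → Θ ⊢ S <: U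
  Arrow : ∀ {Θ S S' T T'} → Θ ⊢ S' <: S → Θ ⊢ T <: T' → Θ ⊢ (S ⇒ T) <: (S' ⇒ T')
  ∀-Fun : ∀ {Θ S T T'} → (tyB S ∷ Θ) ⊢ T <: T' → Θ ⊢ allK S T <: allK S T'
  ∀-Loc : ∀ {Θ S₀ S₁ T₀ T₁} → Θ ⊢ T₀ <: S₀ → (tyB S₀ ∷ Θ) ⊢ S₁ <: T₁ →
          Θ ⊢ allK S₀ S₁ <: allT T₀ T₁
  ∀-Top : ∀ {Θ S₀ S₁ T₀ T₁} → Θ ⊢ T₀ <: S₀ → (tyB top ∷ Θ) ⊢ S₁ <: T₁ →
          Θ ⊢ allT S₀ S₁ <: allT T₀ T₁

-- Θ*(T) : expose  (relation  Expose Θ T U  means  Θ*(T) = U)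

IsVar : Ty → Set
IsVar (var _) = ⊤
IsVar _       = ⊥

data Expose (Θ : Ctx) : Ty → Ty → Set where
  bound   : ∀ {k S U} → TyLookup Θ k S → Expose Θ S U → Expose Θ (var k) U
  unbound : ∀ {k} → ¬ (∃ λ S → TyLookup Θ k S) → Expose Θ (var k) (var k)
  nonvar  : ∀ {T} → ¬ IsVar T → Expose Θ T T

infix 4 _⊢M_∶_
data _⊢M_∶_ : Ctx → Tm → Ty → Set where
  M-Var  : ∀ {Θ x T} → TmLookup Θ x T → Θ ⊢M var x ∶ T
  M-Top  : ∀ {Θ} → Θ ⊢M top ∶ top
  M-Abs  : ∀ {Θ S t T} → (tmB S ∷ Θ) ⊢M t ∶ T → Θ ⊢M lam S t ∶ (S ⇒ T)
  M-App  : ∀ {Θ r s R S S' T} → Θ ⊢M r ∶ R → Θ ⊢M s ∶ S → Θ ⊢ S <: S' →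
           Expose Θ R (S' ⇒ T) → Θ ⊢M app r s ∶ T
  M-TAbs : ∀ {Θ S t T} → (tyB S ∷ Θ) ⊢M t ∶ T → Θ ⊢M Lam S t ∶ allK S T
  M-TAppK : ∀ {Θ r S R S' T} → Θ ⊢M r ∶ R → Θ ⊢ S <: S' →
            Expose Θ R (allK S' T) → Θ ⊢M tapp r S ∶ (T [ S ])
  M-TAppT : ∀ {Θ r S R S' T} → Θ ⊢M r ∶ R → Θ ⊢ S <: S' →
            Expose Θ R (allT S' T) → Θ ⊢M tapp r S ∶ (T [ S ])

FTop : Ty → Set
FTop top        = ⊤
FTop (var _)    = ⊤
FTop (S ⇒ T)    = FTop S × FTop T
FTop (allK S T) = ⊥
FTop (allT S T) = FTop S × FTop T

entryTy : Entry → Ty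
entryTy (tyB T) = T
entryTy (tmB T) = T

FTopCtx : Ctx → Set
FTopCtx Θ = All (λ e → FTop (entryTy e)) Θ

FTopTm : Tm → Set
FTopTm top        = ⊤
FTopTm (var _)    = ⊤
FTopTm (lam S t)  = FTop S × FTopTm t
FTopTm (Lam S t)  = FTop S × FTopTm t
FTopTm (app r s)  = FTopTm r × FTopTm s
FTopTm (tapp r S) = FTopTm r × FTop S

_⊢⊤ty_ : Ctx → Ty → Set
Θ ⊢⊤ty T = FTopCtx Θ × FTop T

_⊢⊤tm_ : Ctx → Tm → Set
Θ ⊢⊤tm t = FTopCtx Θ × FTopTm t

IsLam : Tm → Set
IsLam (lam _ _) = ⊤
IsLam _         = ⊥

IsTLam : Tm → Set
IsTLam (Lam _ _) = ⊤
IsTLam _         = ⊥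

BetaNormal : Tm → Set
BetaNormal top        = ⊤
BetaNormal (var _)    = ⊤
BetaNormal (lam S t)  = BetaNormal t
BetaNormal (Lam S t)  = BetaNormal t
BetaNormal (app r s)  = ¬ IsLam r × BetaNormal r × BetaNormal s
BetaNormal (tapp r S) = ¬ IsTLam r × BetaNormal r

IsAbstraction : Tm → Set
IsAbstraction t = IsLam t ⊎ IsTLam t

module Submission where

open import Defs
open import Data.Nat using (suc; _<ᵇ_; _≡ᵇ_)
open import Data.Bool using (true; false)
open import Data.Product using (_,_; proj₂)
open import Data.Sum using (inj₁; inj₂; [_,_])
open import Data.Unit using (tt)
open import Data.Empty using (⊥-elim)
open import Data.List.Relation.Unary.All using (_∷_)
open import Relation.Nullary using (¬_)

-- F^⊤-types are closed under shifting and substitution, so every type read off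
-- an F^⊤-context, by lookup or by exposing a variable, is an F^⊤-type.  By
-- induction on minimal typing, the type of a β-normal non-abstraction is such a
-- type, the codomain of an exposed arrow, or an instance T[S] of an exposed
-- ∀^⊤-body; an exposed ∀^K cannot occur, as it would have to be an F^⊤-type.
-- The induction applies to heads of applications because they are not
-- abstractions either: β-normality excludes a λ applied to a term and a Λ
-- applied to a type, and in the remaining cases the head's type is a ∀^K-type
-- or an arrow, which exposes to itself and so has the wrong shape.

FTop-shiftFrom : ∀ c T → FTop T → FTop (shiftFrom c T)
FTop-shiftFrom c top        _       = tt
FTop-shiftFrom c (var k)    _       with k <ᵇ c
... | true  = tt
... | false = tt
FTop-shiftFrom c (S ⇒ T)    (s , t) = FTop-shiftFrom c S s , FTop-shiftFrom c T t
FTop-shiftFrom c (allT S T) (s , t) = FTop-shiftFrom c S s , FTop-shiftFrom (suc c) T t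

FTop-substAt : ∀ j U T → FTop U → FTop T → FTop (substAt j U T)
FTop-substAt j U top        _ _       = tt
FTop-substAt j U (var k)    u _       with k <ᵇ j
... | true  = tt
... | false with k ≡ᵇ j
...   | true  = u
...   | false = tt
FTop-substAt j U (S ⇒ T)    u (s , t) = FTop-substAt j U S u s , FTop-substAt j U T u t
FTop-substAt j U (allT S T) u (s , t) =
  FTop-substAt j U S u s , FTop-substAt (suc j) (shift U) T (FTop-shiftFrom 0 U u) t

FTop-TyLookup : ∀ {Θ k T} → FTopCtx Θ → TyLookup Θ k T → FTop T
FTop-TyLookup (s ∷ _) here       = FTop-shiftFrom 0 _ s
FTop-TyLookup (_ ∷ Θ) (there l)  = FTop-shiftFrom 0 _ (FTop-TyLookup Θ l)
FTop-TyLookup (_ ∷ Θ) (skipTm l) = FTop-TyLookup Θ l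

FTop-TmLookup : ∀ {Θ x T} → FTopCtx Θ → TmLookup Θ x T → FTop T
FTop-TmLookup (s ∷ _) here       = s
FTop-TmLookup (_ ∷ Θ) (there l)  = FTop-TmLookup Θ l
FTop-TmLookup (_ ∷ Θ) (skipTy l) = FTop-shiftFrom 0 _ (FTop-TmLookup Θ l)

FTop-Expose : ∀ {Θ R U} → FTopCtx Θ → Expose Θ R U → FTop R → FTop U
FTop-Expose Θ (bound l e) _ = FTop-Expose Θ e (FTop-TyLookup Θ l)
FTop-Expose Θ (unbound _) r = r
FTop-Expose Θ (nonvar _)  r = r

¬IsAbstraction : ∀ {t} → ¬ IsLam t → ¬ IsTLam t → ¬ IsAbstraction t
¬IsAbstraction ¬λ ¬Λ = [ ¬λ , ¬Λ ]

Λ-not-app-head : ∀ {Θ r R S T} → Θ ⊢M r ∶ R → Expose Θ R (S ⇒ T) → ¬ IsTLam r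
Λ-not-app-head (M-TAbs _) ()
Λ-not-app-head {r = top}      _ _ ()
Λ-not-app-head {r = var _}    _ _ ()
Λ-not-app-head {r = lam _ _}  _ _ ()
Λ-not-app-head {r = app _ _}  _ _ ()
Λ-not-app-head {r = tapp _ _} _ _ ()

λ-not-tappK-head : ∀ {Θ r R S T} → Θ ⊢M r ∶ R → Expose Θ R (allK S T) → ¬ IsLam r
λ-not-tappK-head (M-Abs _) ()
λ-not-tappK-head {r = top}      _ _ ()
λ-not-tappK-head {r = var _}    _ _ ()
λ-not-tappK-head {r = Lam _ _}  _ _ ()
λ-not-tappK-head {r = app _ _}  _ _ ()
λ-not-tappK-head {r = tapp _ _} _ _ ()

λ-not-tappT-head : ∀ {Θ r R S T} → Θ ⊢M r ∶ R → Expose Θ R (allT S T) → ¬ IsLam r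
λ-not-tappT-head (M-Abs _) ()
λ-not-tappT-head {r = top}      _ _ ()
λ-not-tappT-head {r = var _}    _ _ ()
λ-not-tappT-head {r = Lam _ _}  _ _ ()
λ-not-tappT-head {r = app _ _}  _ _ ()
λ-not-tappT-head {r = tapp _ _} _ _ ()

FTop-minimalType : ∀ {Θ t T} → Θ ⊢M t ∶ T → FTopCtx Θ → FTopTm t → BetaNormal t →
                   ¬ IsAbstraction t → FTop T
FTop-minimalType (M-Var l) Θ _ _ _ = FTop-TmLookup Θ l
FTop-minimalType M-Top     _ _ _ _ = tt
FTop-minimalType (M-Abs _)  _ _ _ ¬abs = ⊥-elim (¬abs (inj₁ tt))
FTop-minimalType (M-TAbs _) _ _ _ ¬abs = ⊥-elim (¬abs (inj₂ tt))
FTop-minimalType (M-App r _ _ e) Θ (fr , _) (¬λ , nr , _) _ =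
  proj₂ (FTop-Expose Θ e (FTop-minimalType r Θ fr nr (¬IsAbstraction ¬λ (Λ-not-app-head r e))))
FTop-minimalType (M-TAppK r _ e) Θ (fr , _) (¬Λ , nr) _ =
  ⊥-elim (FTop-Expose Θ e (FTop-minimalType r Θ fr nr (¬IsAbstraction (λ-not-tappK-head r e) ¬Λ)))
FTop-minimalType (M-TAppT {S = S} {T = T} r _ e) Θ (fr , fS) (¬Λ , nr) _ =
  FTop-substAt 0 S T fS
    (proj₂ (FTop-Expose Θ e (FTop-minimalType r Θ fr nr (¬IsAbstraction (λ-not-tappT-head r e) ¬Λ))))

mainTheorem13 : (Θ : Ctx) (t : Tm) (T : Ty) →
    Θ ⊢M t ∶ T → Θ ⊢⊤tm t → BetaNormal t → ¬ IsAbstraction t →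
    Θ ⊢⊤ty T
mainTheorem13 _ _ _ ⊢t (⊤Θ , ⊤t) normal ¬abs = ⊤Θ , FTop-minimalType ⊢t ⊤Θ ⊤t normal ¬abs
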